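{- Let $r$ be a positive integer and $R=\lfloor r/2\rfloor$. Let $D$ be a Golomb ruler, and define $f(i,j)=iR+j(R+1)+R^2+R$. Let $\mathcal{A}=\{(i,j)\in\mathbb{Z}^2: |i|+|j|\le R\}$ be the Lee sphere of radius $R$ centred at $(0,0)$, and place a dot at $(i,j)\in\mathcal{A}$ if and only if $f(i,j)\in D$. Then the set of dots is a $\overline{\mathrm{DD}}(m,r)$, where $m=|D\cap\{0,1,\ldots,2R^2+2R\}|$.
   Context: A Golomb ruler is a finite set $D$ of integers such that all differences $a-b$ with $a,b\in D$, $a\ne b$, are distinct. The square grid is $\mathbb{Z}^2$ with Manhattan distance $d((i_1,j_1),(i_2,j_2))=|i_2-i_1|+|j_2-j_1|$. A $\overline{\mathrm{DD}}(m,r)$ is a set of $m$ points ("dots") of $\mathbb{Z}^2$ such that any two dots are at Manhattan distance at most $r$ and the vectors $a-b$, over ordered pairs $(a,b)$ of distinct dots, are pairwise distinct. -}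

module Defs where

open import Data.Nat as ℕ using (ℕ; suc; NonZero)
open import Data.Nat.DivMod using (_/_)
open import Data.Integer as ℤ using (ℤ; +_; ∣_∣; _-_)
open import Data.Integer.Properties as ℤP using ()
open import Data.Product using (Σ; _×_; _,_)
open import Data.List using (List; length; filter)
open import Data.List.Membership.Propositional using (_∈_)
open import Data.List.Relation.Unary.Unique.Propositional using (Unique)
open import Relation.Binary.PropositionalEquality using (_≡_; _≢_)
open import Relation.Nullary.Decidable using (_×-dec_)

Point : Set
Point = ℤ × ℤ

-- A finite set of integers is represented by a duplicate-free list.
GolombRuler : List ℤ → Set
GolombRuler D =
  Unique D ×
  (∀ {a b c d} → a ∈ D → b ∈ D → c ∈ D → d ∈ D → a ≢ b → c ≢ d →
     a - b ≡ c - d → (a ≡ c × b ≡ d))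

dist : Point → Point → ℕ
dist (i₁ , j₁) (i₂ , j₂) = ∣ i₂ - i₁ ∣ ℕ.+ ∣ j₂ - j₁ ∣

vsub : Point → Point → Point
vsub (i₁ , j₁) (i₂ , j₂) = (i₁ - i₂ , j₁ - j₂)

DDbar : ℕ → ℕ → List Point → Set
DDbar m r S =
  Unique S ×
  length S ≡ m ×
  (∀ {a b} → a ∈ S → b ∈ S → dist a b ℕ.≤ r) ×
  (∀ {a b c d} → a ∈ S → b ∈ S → c ∈ S → d ∈ S → a ≢ b → c ≢ d →
     vsub a b ≡ vsub c d → (a ≡ c × b ≡ d))

half : ℕ → ℕ
half r = r / 2

fR : ℕ → Point → ℤ
fR R (i , j) = i ℤ.* + R ℤ.+ j ℤ.* + (R ℕ.+ 1) ℤ.+ + (R ℕ.* R ℕ.+ R)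

InLee : ℕ → Point → Set
InLee R (i , j) = ∣ i ∣ ℕ.+ ∣ j ∣ ℕ.≤ R

countRange : ℕ → List ℤ → ℕ
countRange R D =
  length (filter (λ x → (+ 0 ℤ.≤? x) ×-dec (x ℤ.≤? + (2 ℕ.* R ℕ.* R ℕ.+ 2 ℕ.* R))) D)

module Submission where

-- In the rotated coordinates u = i + j + R and v = j - i + R the Lee sphere of radius R
-- is the set of points with u, v ∈ [0, 2R], and 2 f(i, j) = v + u (2R + 1).  So u and v
-- are the two base-(2R + 1) digits of 2 f: f is injective on the sphere and maps it onto
-- [0, 2R² + 2R], and decoding the digits of 2x inverts it there.  The dots are thus the
-- decoded elements of D ∩ [0, 2R² + 2R].  As f is affine, two pairs of dots with the same
-- difference vector give two pairs of D with the same difference, which the Golomb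
-- property forces to coincide; and the sphere has diameter 2R ≤ r.

open import Defs
open import Data.Nat using (ℕ; _>_)
open import Data.Integer using (ℤ)
open import Data.Product using (Σ; _×_)
open import Data.List using (List)
open import Data.List.Membership.Propositional using (_∈_)
open import Function.Bundles using (_⇔_)

open import Data.Product using (_,_; proj₁; proj₂)
open import Data.Sum using (_⊎_; inj₁; inj₂)
open import Data.List.Base using ([]; _∷_)
open import Relation.Binary.PropositionalEquality
open import Data.Nat.Properties using (≤-trans)
open import Function using (_∘_)
open import Function.Bundles using (mk⇔)

module _ where
  open import Data.Nat
  open import Data.Nat.Properties
  open import Data.Nat.DivMod
  open import Data.Nat.Tactic.RingSolver using (solve)

  [m+kn]/n≡k : ∀ {m n} k .{{_ : NonZero n}} → m < n → (m + k * n) / n ≡ k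
  [m+kn]/n≡k {m} {n} k m<n = begin
    (m + k * n) / n    ≡⟨ +-distrib-/ m (k * n) remainders<n ⟩
    m / n + k * n / n  ≡⟨ cong₂ _+_ (m<n⇒m/n≡0 m<n) (m*n/n≡m k n) ⟩
    k                  ∎
    where
    open ≡-Reasoning
    remainders<n : m % n + k * n % n < n
    remainders<n = subst (_< n) (sym (trans (cong₂ _+_ (m<n⇒m%n≡m m<n) (m*n%n≡0 k n))
                                            (+-identityʳ m))) m<n

  [m+kn]%n≡m : ∀ {m n} k .{{_ : NonZero n}} → m < n → (m + k * n) % n ≡ m
  [m+kn]%n≡m {m} {n} k m<n = trans ([m+kn]%n≡m%n m k n) (m<n⇒m%n≡m m<n)

  digits-injective : ∀ {n a b c d} .{{_ : NonZero n}} → a < n → c < n →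
                     a + b * n ≡ c + d * n → a ≡ c × b ≡ d
  digits-injective {n} {b = b} {d = d} a<n c<n eq =
    trans (sym ([m+kn]%n≡m b a<n)) (trans (cong (_% n) eq) ([m+kn]%n≡m d c<n)) ,
    trans (sym ([m+kn]/n≡k b a<n)) (trans (cong (_/ n) eq) ([m+kn]/n≡k d c<n))

  2*[n/2]≤n : ∀ n → 2 * (n / 2) ≤ n
  2*[n/2]≤n n = subst (_≤ n) (*-comm (n / 2) 2) (m/n*n≤m n 2)

  2*[x∸R*a]≡a+b : ∀ R x a b → 2 * x ≡ b + a * suc (2 * R) → 2 * (x ∸ R * a) ≡ a + b
  2*[x∸R*a]≡a+b R x a b 2x≡b+aK = begin
    2 * (x ∸ R * a)                      ≡⟨ *-distribˡ-∸ 2 x (R * a) ⟩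
    2 * x ∸ 2 * (R * a)                  ≡⟨ cong (_∸ 2 * (R * a)) (trans 2x≡b+aK b+aK≡) ⟩
    2 * (R * a) + (a + b) ∸ 2 * (R * a)  ≡⟨ m+n∸m≡n (2 * (R * a)) (a + b) ⟩
    a + b                                ∎
    where
    open ≡-Reasoning
    b+aK≡ : b + a * suc (2 * R) ≡ 2 * (R * a) + (a + b)
    b+aK≡ = solve (R ∷ a ∷ b ∷ [])

  2x/[1+2R]≤2R : ∀ R x → x ≤ 2 * R * R + 2 * R → 2 * x / suc (2 * R) ≤ 2 * R
  2x/[1+2R]≤2R R x x≤top = s≤s⁻¹ (m<n*o⇒m/o<n (begin-strict
    2 * x                              ≤⟨ *-monoʳ-≤ 2 x≤top ⟩
    2 * (2 * R * R + 2 * R)            <⟨ n<1+n _ ⟩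
    suc (2 * (2 * R * R + 2 * R))      ≡⟨ solve (R ∷ []) ⟩
    suc (2 * R) * suc (2 * R)          ∎))
    where open ≤-Reasoning

  digits⇒≤top : ∀ R x a b → a ≤ 2 * R → b ≤ 2 * R → 2 * x ≡ b + a * suc (2 * R) →
                x ≤ 2 * R * R + 2 * R
  digits⇒≤top R x a b a≤2R b≤2R 2x≡b+aK = *-cancelˡ-≤ 2 (begin
    2 * x                              ≡⟨ 2x≡b+aK ⟩
    b + a * suc (2 * R)                ≤⟨ +-mono-≤ b≤2R (*-monoˡ-≤ (suc (2 * R)) a≤2R) ⟩
    2 * R + 2 * R * suc (2 * R)        ≡⟨ solve (R ∷ []) ⟩
    2 * (2 * R * R + 2 * R)            ∎)
    where open ≤-Reasoning

module _ where
  open import Data.Integer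
  open import Data.Integer.Properties
  import Data.Nat as ℕ
  import Data.Nat.Properties as ℕ

  ∣i∣+∣j∣≡∣i+j∣⊎∣j-i∣ : ∀ i j → ∣ i ∣ ℕ.+ ∣ j ∣ ≡ ∣ i + j ∣ ⊎ ∣ i ∣ ℕ.+ ∣ j ∣ ≡ ∣ j - i ∣
  ∣i∣+∣j∣≡∣i+j∣⊎∣j-i∣ (+ m)    (+ n)    = inj₁ refl
  ∣i∣+∣j∣≡∣i+j∣⊎∣j-i∣ -[1+ m ] -[1+ n ] = inj₁ (cong ℕ.suc (ℕ.+-suc m n))
  ∣i∣+∣j∣≡∣i+j∣⊎∣j-i∣ +0       -[1+ n ] = inj₂ refl
  ∣i∣+∣j∣≡∣i+j∣⊎∣j-i∣ +[1+ m ] -[1+ n ] = inj₂ (cong ℕ.suc (trans (ℕ.+-suc m n) (cong ℕ.suc (ℕ.+-comm m n))))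
  ∣i∣+∣j∣≡∣i+j∣⊎∣j-i∣ -[1+ m ] (+ n)    = inj₂ (ℕ.+-comm (ℕ.suc m) n)

  ∣i+j∣≤n⇒∣j-i∣≤n⇒∣i∣+∣j∣≤n : ∀ i j {n} → ∣ i + j ∣ ℕ.≤ n → ∣ j - i ∣ ℕ.≤ n → ∣ i ∣ ℕ.+ ∣ j ∣ ℕ.≤ n
  ∣i+j∣≤n⇒∣j-i∣≤n⇒∣i∣+∣j∣≤n i j {n} ∣i+j∣≤n ∣j-i∣≤n with ∣i∣+∣j∣≡∣i+j∣⊎∣j-i∣ i j
  ... | inj₁ eq = subst (ℕ._≤ n) (sym eq) ∣i+j∣≤n
  ... | inj₂ eq = subst (ℕ._≤ n) (sym eq) ∣j-i∣≤n

  ∣i∣≤n⇒i+n≡+a : ∀ i {n} → ∣ i ∣ ℕ.≤ n → Σ ℕ λ a → a ℕ.≤ 2 ℕ.* n × i + + n ≡ + a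
  ∣i∣≤n⇒i+n≡+a (+ m)    {n} m≤n = m ℕ.+ n , ℕ.+-mono-≤ m≤n (ℕ.m≤m+n n 0) , refl
  ∣i∣≤n⇒i+n≡+a -[1+ m ] {n} m<n =
    n ℕ.∸ ℕ.suc m , ℕ.≤-trans (ℕ.m∸n≤m n (ℕ.suc m)) (ℕ.m≤m+n n (n ℕ.+ 0)) , ⊖-≥ m<n

  ∣+a-+n∣≤n : ∀ {a n} → a ℕ.≤ 2 ℕ.* n → ∣ + a - + n ∣ ℕ.≤ n
  ∣+a-+n∣≤n {a} {n} a≤2n rewrite m-n≡m⊖n a n with ℕ.≤-total a n
  ... | inj₁ a≤n = subst (ℕ._≤ n) (sym (∣⊖∣-≤ a≤n)) (ℕ.m∸n≤m n a)
  ... | inj₂ n≤a = subst (λ z → ∣ z ∣ ℕ.≤ n) (sym (⊖-≥ n≤a))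
                     (ℕ.m≤n+o⇒m∸n≤o a n (subst (a ℕ.≤_) (cong (n ℕ.+_) (ℕ.+-identityʳ n)) a≤2n))

  i+n≡+a⇒∣i∣≤n : ∀ i {n a} → a ℕ.≤ 2 ℕ.* n → i + + n ≡ + a → ∣ i ∣ ℕ.≤ n
  i+n≡+a⇒∣i∣≤n i {n} {a} a≤2n i+n≡a = subst (λ z → ∣ z ∣ ℕ.≤ n) (sym i≡a-n) (∣+a-+n∣≤n a≤2n)
    where
    open ≡-Reasoning
    i≡a-n : i ≡ + a - + n
    i≡a-n = begin
      i                    ≡⟨ sym (+-identityʳ i) ⟩
      i + 0ℤ               ≡⟨ cong (_+_ i) (sym (+-inverseʳ (+ n))) ⟩
      i + (+ n - + n)      ≡⟨ sym (+-assoc i (+ n) (- + n)) ⟩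
      i + + n - + n        ≡⟨ cong (_- + n) i+n≡a ⟩
      + a - + n            ∎

  2i≡+n⇒i≡+x : ∀ {i n} → + 2 * i ≡ + n → Σ ℕ λ x → i ≡ + x × 2 ℕ.* x ≡ n
  2i≡+n⇒i≡+x {+ x} 2x≡n = x , refl , +-injective (trans (pos-* 2 x) 2x≡n)

module LeeSphere (R : ℕ) where
  open import Data.Integer
  open import Data.Integer.Properties
  open import Data.Integer.Tactic.RingSolver using (solve-∀)
  open import Data.Nat as ℕ using (s≤s; s≤s⁻¹)
  import Data.Nat.Properties as ℕ
  open import Data.Nat.DivMod using (m≡m%n+[m/n]*n; m%n<n)

  K : ℕ
  K = ℕ.suc (2 ℕ.* R)

  top : ℕ
  top = 2 ℕ.* R ℕ.* R ℕ.+ 2 ℕ.* R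

  u v : Point → ℤ
  u (i , j) = i + j + + R
  v (i , j) = j - i + + R

  IsDigit : ℤ → Set
  IsDigit z = Σ ℕ λ a → a ℕ.≤ 2 ℕ.* R × z ≡ + a

  InLee⇒digits : ∀ p → InLee R p → IsDigit (u p) × IsDigit (v p)
  InLee⇒digits (i , j) lee =
    ∣i∣≤n⇒i+n≡+a (i + j) (ℕ.≤-trans (∣i+j∣≤∣i∣+∣j∣ i j) lee) ,
    ∣i∣≤n⇒i+n≡+a (j - i) (ℕ.≤-trans (∣i-j∣≤∣i∣+∣j∣ j i) (subst (ℕ._≤ R) (ℕ.+-comm ∣ i ∣ ∣ j ∣) lee))

  digits⇒InLee : ∀ p → IsDigit (u p) → IsDigit (v p) → InLee R p
  digits⇒InLee (i , j) (a , a≤2R , u≡a) (b , b≤2R , v≡b) =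
    ∣i+j∣≤n⇒∣j-i∣≤n⇒∣i∣+∣j∣≤n i j (i+n≡+a⇒∣i∣≤n (i + j) a≤2R u≡a) (i+n≡+a⇒∣i∣≤n (j - i) b≤2R v≡b)

  dist-InLee : ∀ p q → InLee R p → InLee R q → dist p q ℕ.≤ 2 ℕ.* R
  dist-InLee (i₁ , j₁) (i₂ , j₂) lee₁ lee₂ = begin
    dist (i₁ , j₁) (i₂ , j₂)                     ≤⟨ ℕ.+-mono-≤ (∣i-j∣≤∣i∣+∣j∣ i₂ i₁) (∣i-j∣≤∣i∣+∣j∣ j₂ j₁) ⟩
    (∣ i₂ ∣ ℕ.+ ∣ i₁ ∣) ℕ.+ (∣ j₂ ∣ ℕ.+ ∣ j₁ ∣)  ≡⟨ interchange (∣ i₂ ∣) (∣ i₁ ∣) (∣ j₂ ∣) (∣ j₁ ∣) ⟩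
    (∣ i₂ ∣ ℕ.+ ∣ j₂ ∣) ℕ.+ (∣ i₁ ∣ ℕ.+ ∣ j₁ ∣)  ≤⟨ ℕ.+-mono-≤ lee₂ lee₁ ⟩
    R ℕ.+ R                                      ≡⟨ cong (R ℕ.+_) (sym (ℕ.+-identityʳ R)) ⟩
    2 ℕ.* R                                      ∎
    where
    open ℕ.≤-Reasoning
    open import Algebra.Properties.CommutativeSemigroup ℕ.+-commutativeSemigroup using (interchange)

  rotation-injective : ∀ {p q} → u p ≡ u q → v p ≡ v q → p ≡ q
  rotation-injective {i , j} {k , l} u≡ v≡ = cong₂ _,_
    (*-cancelˡ-≡ (+ 2) i k (begin
      + 2 * i                        ≡⟨ 2i≡u-v i j (+ R) ⟩
      u (i , j) - v (i , j)          ≡⟨ cong₂ _-_ u≡ v≡ ⟩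
      u (k , l) - v (k , l)          ≡⟨ sym (2i≡u-v k l (+ R)) ⟩
      + 2 * k                        ∎))
    (*-cancelˡ-≡ (+ 2) j l (begin
      + 2 * j                        ≡⟨ 2j≡u+v-2r i j (+ R) ⟩
      u (i , j) + v (i , j) - + 2 * + R  ≡⟨ cong (λ w → w - + 2 * + R) (cong₂ _+_ u≡ v≡) ⟩
      u (k , l) + v (k , l) - + 2 * + R  ≡⟨ sym (2j≡u+v-2r k l (+ R)) ⟩
      + 2 * l                        ∎))
    where
    open ≡-Reasoning
    2i≡u-v : ∀ i j r → + 2 * i ≡ (i + j + r) - (j - i + r)
    2i≡u-v = solve-∀
    2j≡u+v-2r : ∀ i j r → + 2 * j ≡ (i + j + r) + (j - i + r) - + 2 * r
    2j≡u+v-2r = solve-∀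

  fR-expand : ∀ i j → fR R (i , j) ≡ i * + R + j * (+ R + + 1) + (+ R * + R + + R)
  fR-expand i j = cong₂ (λ a b → i * + R + j * a + b) (pos-+ R 1)
    (trans (pos-+ (R ℕ.* R) R) (cong (_+ + R) (pos-* R R)))

  2fR≡v+u*K : ∀ p → + 2 * fR R p ≡ v p + u p * + K
  2fR≡v+u*K (i , j) = begin
    + 2 * fR R (i , j)                                       ≡⟨ cong (_*_ (+ 2)) (fR-expand i j) ⟩
    + 2 * (i * + R + j * (+ R + + 1) + (+ R * + R + + R))    ≡⟨ poly i j (+ R) ⟩
    v (i , j) + u (i , j) * (+ 1 + + 2 * + R)                ≡⟨ cong (λ k → v (i , j) + u (i , j) * k) (sym +K≡) ⟩
    v (i , j) + u (i , j) * + K                              ∎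
    where
    open ≡-Reasoning
    poly : ∀ i j r → + 2 * (i * r + j * (r + + 1) + (r * r + r)) ≡ (j - i + r) + (i + j + r) * (+ 1 + + 2 * r)
    poly = solve-∀
    +K≡ : + K ≡ + 1 + + 2 * + R
    +K≡ = trans (pos-+ 1 (2 ℕ.* R)) (cong (_+_ (+ 1)) (pos-* 2 R))

  fR-vsub : ∀ p q → fR R p - fR R q ≡ fR R (vsub p q) - fR R (+ 0 , + 0)
  fR-vsub (i₁ , j₁) (i₂ , j₂) =
    trans (cong₂ _-_ (fR-expand i₁ j₁) (fR-expand i₂ j₂))
      (trans (poly i₁ j₁ i₂ j₂ (+ R))
        (sym (cong₂ _-_ (fR-expand (i₁ - i₂) (j₁ - j₂)) (fR-expand (+ 0) (+ 0)))))
    where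
    poly : ∀ i₁ j₁ i₂ j₂ r →
      (i₁ * r + j₁ * (r + + 1) + (r * r + r)) - (i₂ * r + j₂ * (r + + 1) + (r * r + r)) ≡
      ((i₁ - i₂) * r + (j₁ - j₂) * (r + + 1) + (r * r + r)) - (+ 0 * r + + 0 * (r + + 1) + (r * r + r))
    poly = solve-∀

  fR-respects-vsub : ∀ a b c d → vsub a b ≡ vsub c d → fR R a - fR R b ≡ fR R c - fR R d
  fR-respects-vsub a b c d ab≡cd =
    trans (fR-vsub a b) (trans (cong (λ w → fR R w - fR R (+ 0 , + 0)) ab≡cd) (sym (fR-vsub c d)))

  2fR≡digits : ∀ p {a b} → u p ≡ + a → v p ≡ + b → + 2 * fR R p ≡ + (b ℕ.+ a ℕ.* K)
  2fR≡digits p {a} {b} u≡a v≡b = begin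
    + 2 * fR R p          ≡⟨ 2fR≡v+u*K p ⟩
    v p + u p * + K       ≡⟨ cong₂ (λ x y → y + x * + K) u≡a v≡b ⟩
    + b + + a * + K       ≡⟨ cong (_+_ (+ b)) (sym (pos-* a K)) ⟩
    + b + + (a ℕ.* K)     ≡⟨ sym (pos-+ b (a ℕ.* K)) ⟩
    + (b ℕ.+ a ℕ.* K)     ∎
    where open ≡-Reasoning

  fR-injective : ∀ {p q} → InLee R p → InLee R q → fR R p ≡ fR R q → p ≡ q
  fR-injective {p} {q} lee-p lee-q fp≡fq with InLee⇒digits p lee-p | InLee⇒digits q lee-q
  ... | (a , _ , u≡a) , (b , b≤2R , v≡b) | (c , _ , u≡c) , (d , d≤2R , v≡d) =
    rotation-injective (trans u≡a (trans (cong +_ (proj₂ b≡d×a≡c)) (sym u≡c)))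
                       (trans v≡b (trans (cong +_ (proj₁ b≡d×a≡c)) (sym v≡d)))
    where
    open ≡-Reasoning
    b≡d×a≡c : b ≡ d × a ≡ c
    b≡d×a≡c = digits-injective (s≤s b≤2R) (s≤s d≤2R) (+-injective (begin
      + (b ℕ.+ a ℕ.* K)  ≡⟨ sym (2fR≡digits p u≡a v≡b) ⟩
      + 2 * fR R p       ≡⟨ cong (_*_ (+ 2)) fp≡fq ⟩
      + 2 * fR R q       ≡⟨ 2fR≡digits q u≡c v≡d ⟩
      + (d ℕ.+ c ℕ.* K)  ∎))

  fR-range : ∀ p → InLee R p → Σ ℕ λ x → fR R p ≡ + x × x ℕ.≤ top
  fR-range p lee with InLee⇒digits p lee
  ... | (a , a≤2R , u≡a) , (b , b≤2R , v≡b) with 2i≡+n⇒i≡+x (2fR≡digits p u≡a v≡b)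
  ... | x , fp≡x , 2x≡b+aK = x , fp≡x , digits⇒≤top R x a b a≤2R b≤2R 2x≡b+aK

  digit₁ digit₀ centre : ℕ → ℕ
  digit₁ x = 2 ℕ.* x ℕ./ K
  digit₀ x = 2 ℕ.* x ℕ.% K
  centre x = x ℕ.∸ R ℕ.* digit₁ x

  -- decode x has u = digit₁ x and v = digit₀ x; centre x stands for (u + v) / 2.
  decode : ℕ → Point
  decode x = (+ centre x - + digit₀ x , + centre x - + R)

  2x≡digits : ∀ x → 2 ℕ.* x ≡ digit₀ x ℕ.+ digit₁ x ℕ.* K
  2x≡digits x = m≡m%n+[m/n]*n (2 ℕ.* x) K

  u-decode : ∀ x → u (decode x) ≡ + digit₁ x
  u-decode x = begin
    (+ c - + b) + (+ c - + R) + + R  ≡⟨ poly (+ c) (+ b) (+ R) ⟩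
    + 2 * + c - + b                  ≡⟨ cong (_- + b) 2c≡a+b ⟩
    + a + + b - + b                  ≡⟨ cancel (+ a) (+ b) ⟩
    + a                              ∎
    where
    open ≡-Reasoning
    a = digit₁ x
    b = digit₀ x
    c = centre x
    poly : ∀ c b r → (c - b) + (c - r) + r ≡ + 2 * c - b
    poly = solve-∀
    cancel : ∀ a b → a + b - b ≡ a
    cancel = solve-∀
    2c≡a+b : + 2 * + c ≡ + a + + b
    2c≡a+b = trans (sym (pos-* 2 c)) (trans (cong +_ (2*[x∸R*a]≡a+b R x a b (2x≡digits x))) (pos-+ a b))

  v-decode : ∀ x → v (decode x) ≡ + digit₀ x
  v-decode x = poly (+ centre x) (+ digit₀ x) (+ R)
    where
    poly : ∀ c b r → (c - r) - (c - b) + r ≡ b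
    poly = solve-∀

  fR-decode : ∀ x → fR R (decode x) ≡ + x
  fR-decode x = *-cancelˡ-≡ (+ 2) (fR R (decode x)) (+ x) (begin
    + 2 * fR R (decode x)              ≡⟨ 2fR≡digits (decode x) (u-decode x) (v-decode x) ⟩
    + (digit₀ x ℕ.+ digit₁ x ℕ.* K)    ≡⟨ cong +_ (sym (2x≡digits x)) ⟩
    + (2 ℕ.* x)                        ≡⟨ pos-* 2 x ⟩
    + 2 * + x                          ∎)
    where open ≡-Reasoning

  decode-InLee : ∀ {x} → x ℕ.≤ top → InLee R (decode x)
  decode-InLee {x} x≤top = digits⇒InLee (decode x)
    (digit₁ x , 2x/[1+2R]≤2R R x x≤top , u-decode x)
    (digit₀ x , s≤s⁻¹ (m%n<n (2 ℕ.* x) K) , v-decode x)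

module Dots (R : ℕ) (D : List ℤ) where
  open LeeSphere R
  open import Data.Nat as ℕ using (z≤n)
  open import Data.Integer using (∣_∣; +_; _≤_; _≤?_; +≤+)
  open import Data.Integer.Properties using (drop‿+≤+)
  open import Data.List using (map; filter; length)
  open import Data.List.Properties using (map-∘; map-id-local; length-map)
  open import Data.List.Membership.Propositional.Properties using (∈-map⁺; ∈-map⁻; ∈-filter⁺; ∈-filter⁻)
  open import Data.List.Relation.Unary.All using (tabulate)
  open import Data.List.Relation.Unary.Unique.Propositional using (Unique)
  open import Data.List.Relation.Unary.Unique.Propositional.Properties using (map⁻; filter⁺)
  open import Relation.Nullary.Decidable using (_×-dec_)
  open import Relation.Unary using (Decidable)

  InRange : ℤ → Set
  InRange x = + 0 ≤ x × x ≤ + top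

  inRange? : Decidable InRange
  inRange? x = (+ 0 ≤? x) ×-dec (x ≤? + top)

  dots : List Point
  dots = map (decode ∘ ∣_∣) (filter inRange? D)

  ∈-inRange⇒ : ∀ {z} → z ∈ filter inRange? D → Σ ℕ λ x → z ≡ + x × x ℕ.≤ top × z ∈ D
  ∈-inRange⇒ z∈ with ∈-filter⁻ inRange? {xs = D} z∈
  ... | z∈D , (+≤+ {n = x} _ , x≤top) = x , refl , drop‿+≤+ x≤top , z∈D

  ∈dots⇒ : ∀ {p} → p ∈ dots → InLee R p × fR R p ∈ D
  ∈dots⇒ p∈ with ∈-map⁻ (decode ∘ ∣_∣) p∈
  ... | z , z∈ , refl with ∈-inRange⇒ z∈
  ... | x , refl , x≤top , x∈D = decode-InLee x≤top , subst (_∈ D) (sym (fR-decode x)) x∈D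

  ⇒∈dots : ∀ {p} → InLee R p × fR R p ∈ D → p ∈ dots
  ⇒∈dots {p} (lee , fp∈D) = from-value (fR-range p lee)
    where
    from-value : (Σ ℕ λ x → fR R p ≡ + x × x ℕ.≤ top) → p ∈ dots
    from-value (x , fp≡x , x≤top) = subst (_∈ dots) decode-x≡p (∈-map⁺ (decode ∘ ∣_∣) +x∈)
      where
      +x∈ : + x ∈ filter inRange? D
      +x∈ = ∈-filter⁺ inRange? {xs = D} (subst (_∈ D) fp≡x fp∈D) (+≤+ z≤n , +≤+ x≤top)
      decode-x≡p : decode x ≡ p
      decode-x≡p = fR-injective (decode-InLee x≤top) lee (trans (fR-decode x) (sym fp≡x))

  dots-unique : Unique D → Unique dots
  dots-unique uD = map⁻ (subst Unique (sym fR∘dots≡) (filter⁺ inRange? uD))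
    where
    fR∘decode≡id : ∀ {z} → z ∈ filter inRange? D → fR R (decode ∣ z ∣) ≡ z
    fR∘decode≡id z∈ with ∈-inRange⇒ z∈
    ... | x , refl , _ = fR-decode x
    fR∘dots≡ : map (fR R) dots ≡ filter inRange? D
    fR∘dots≡ = trans (sym (map-∘ (filter inRange? D))) (map-id-local (tabulate fR∘decode≡id))

  dots-length : length dots ≡ countRange R D
  dots-length = length-map (decode ∘ ∣_∣) (filter inRange? D)

  dots-diameter : ∀ {a b} → a ∈ dots → b ∈ dots → dist a b ℕ.≤ 2 ℕ.* R
  dots-diameter {a} {b} a∈ b∈ = dist-InLee a b (proj₁ (∈dots⇒ a∈)) (proj₁ (∈dots⇒ b∈))

  dots-fR-injective : ∀ {a b} → a ∈ dots → b ∈ dots → fR R a ≡ fR R b → a ≡ b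
  dots-fR-injective a∈ b∈ = fR-injective (proj₁ (∈dots⇒ a∈)) (proj₁ (∈dots⇒ b∈))

  dots-distinct-differences : GolombRuler D → ∀ {a b c d} →
    a ∈ dots → b ∈ dots → c ∈ dots → d ∈ dots → a ≢ b → c ≢ d →
    vsub a b ≡ vsub c d → a ≡ c × b ≡ d
  dots-distinct-differences (_ , golomb) {a} {b} {c} {d} a∈ b∈ c∈ d∈ a≢b c≢d ab≡cd =
    dots-fR-injective a∈ c∈ (proj₁ fa≡fc×fb≡fd) , dots-fR-injective b∈ d∈ (proj₂ fa≡fc×fb≡fd)
    where
    fR∈D : ∀ {p} → p ∈ dots → fR R p ∈ D
    fR∈D = proj₂ ∘ ∈dots⇒
    fa≡fc×fb≡fd : fR R a ≡ fR R c × fR R b ≡ fR R d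
    fa≡fc×fb≡fd = golomb (fR∈D a∈) (fR∈D b∈) (fR∈D c∈) (fR∈D d∈)
      (a≢b ∘ dots-fR-injective a∈ b∈) (c≢d ∘ dots-fR-injective c∈ d∈) (fR-respects-vsub a b c d ab≡cd)

theorem16 : (r : ℕ) → r > 0 → (D : List ℤ) → GolombRuler D →
    Σ (List Point) (λ S →
      (∀ p → (p ∈ S) ⇔ (InLee (half r) p × fR (half r) p ∈ D)) ×
      DDbar (countRange (half r) D) r S)
theorem16 r _ D golomb =
  dots ,
  (λ p → mk⇔ ∈dots⇒ ⇒∈dots) ,
  dots-unique (proj₁ golomb) ,
  dots-length ,
  (λ a∈ b∈ → ≤-trans (dots-diameter a∈ b∈) (2*[n/2]≤n r)) ,
  dots-distinct-differences golomb
  where open Dots (half r) D
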